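{- Let $K$ be a field of characteristic $0$, let $a,b,c\in K$, and let $d$ be an element of some extension field $L\supseteq K$ with $d^2=b^2-4c$. Put $$q=\frac{b-d}{2},\qquad r=-d,\qquad s=-\frac{2a-d-b}{2}.$$ Then $a=q-r-s$, $b=2q-r$, $c=q(q-r)$, and the revert transform of $\frac{1+ax}{1+bx+cx^2}$ is equal to the Thron-type continued fraction $$\cfrac{1}{1-qx-\cfrac{sx}{1-rx-\cfrac{sx}{1-rx-\cfrac{sx}{1-rx-\cdots}}}}.$$
   Context: For $h(x)\in L[[x]]$ with $h(0)\ne0$, the revert transform of $h$ is $\frac1x$ times the compositional inverse of $xh(x)$. The Thron-type continued fraction $\cfrac{1}{1-qx-\cfrac{sx}{1-rx-\cfrac{sx}{1-rx-\cdots}}}$ denotes the formal power series $\frac{1}{1-qx-sxU(x)}$, where $U(x)\in L[[x]]$ is the unique power series satisfying $U(x)=\frac{1}{1-rx-sxU(x)}$. -}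

module Defs where

open import Level using (Level; _⊔_) renaming (suc to lsuc)
open import Data.Nat as ℕ using (ℕ; zero; suc)
open import Data.Product using (_×_)
open import Relation.Nullary using (¬_)
open import Algebra.Bundles using (CommutativeRing)
open import Algebra.Morphism.Structures using (module RingMorphisms)

record Field (c ℓ : Level) : Set (lsuc (c ⊔ ℓ)) where
  field
    commutativeRing : CommutativeRing c ℓ
  open CommutativeRing commutativeRing public hiding (zero)
  field
    _⁻¹       : Carrier → Carrier
    1≉0       : ¬ (1# ≈ 0#)
    inverseʳ  : ∀ x → ¬ (x ≈ 0#) → (x * (x ⁻¹)) ≈ 1#

module RingNotions {c ℓ : Level} (R : CommutativeRing c ℓ) where
  open CommutativeRing R hiding (zero)

  natCast : ℕ → Carrier
  natCast zero    = 0#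
  natCast (suc n) = 1# + natCast n

  CharZero : Set ℓ
  CharZero = ∀ n → ¬ (natCast (suc n) ≈ 0#)

  Series : Set c
  Series = ℕ → Carrier

  infix 4 _≋_
  _≋_ : Series → Series → Set ℓ
  f ≋ g = ∀ n → f n ≈ g n

  sumTo : ℕ → (ℕ → Carrier) → Carrier
  sumTo zero    f = f zero
  sumTo (suc n) f = sumTo n f + f (suc n)

  const : Carrier → Series
  const a zero    = a
  const a (suc n) = 0#

  X : Series
  X zero          = 0#
  X (suc zero)    = 1#
  X (suc (suc n)) = 0#

  infixl 6 _⊕_ _⊖_
  infixl 7 _⊛_ _·ₛ_
  _⊕_ : Series → Series → Series
  (f ⊕ g) n = f n + g n

  _⊖_ : Series → Series → Series
  (f ⊖ g) n = f n - g n

  _·ₛ_ : Carrier → Series → Series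
  (a ·ₛ f) n = a * f n

  _⊛_ : Series → Series → Series
  (f ⊛ g) n = sumTo n (λ i → f i * g (n ℕ.∸ i))

  pow : Series → ℕ → Series
  pow f zero    = const 1#
  pow f (suc k) = f ⊛ pow f k

  -- composition F(G(x)), meaningful when G(0) = 0 (only terms k ≤ n contribute)
  compose : Series → Series → Series
  compose F G n = sumTo n (λ k → F k * pow G k n)

  IsCompInverse : Series → Series → Set ℓ
  IsCompInverse F G = (G 0 ≈ 0#) × (compose F G ≋ X)

  IsRevertTransform : Series → Series → Set ℓ
  IsRevertTransform h Rv = IsCompInverse (X ⊛ h) (X ⊛ Rv)

-- Put G = xT and D = 1 − qx − sxU, so that T·D = 1 and G·D = x. The equation
-- U(1 − rx − sxU) = 1 turns into the quadratic relation D² + bxD + cx² = D + ax, that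
-- is E(G)·D = N(G) for E(y) = 1 + by + cy² and N(y) = 1 + ay. Composing E(x)h(x) = N(x)
-- with G gives E(G)·h(G) = N(G), and E(G) has constant term 1, so it cancels:
-- h(G) = D and therefore G·h(G) = G·D = x. The relations a = q − r − s, b = 2q − r,
-- c = q(q − r) are ring identities once 2·(1/2) = 1 and d² = b² − 4c are used; 2 ≠ 0
-- in L because L contains the characteristic-0 field K.
module Submission where

open import Defs
open import Data.Product using (_×_)
open import Algebra.Morphism.Structures using (module RingMorphisms)

open import Level using (Level)
open import Algebra.Bundles using (CommutativeRing)
open import Algebra.Solver.Ring.AlmostCommutativeRing
  using (fromCommutativeRing; _-Raw-AlmostCommutative⟶_)
open import Data.Integer as ℤ using (ℤ; +_; -[1+_])
import Data.Integer.Properties as ℤ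
open import Data.Maybe using (Maybe; just; nothing)
open import Data.Nat as ℕ using (ℕ; zero; suc; _≤_; _<_; _≤′_; ≤′-refl; ≤′-step; s≤s)
import Data.Nat.Properties as ℕ
open import Data.Nat.Induction using (<-rec)
open import Data.Product using (_,_)
open import Data.Sign as Sign using (Sign)
import Relation.Binary.PropositionalEquality as ≡
open import Relation.Nullary using (¬_; yes; no)

module IntegerRingSolver {c ℓ : Level} (R : CommutativeRing c ℓ) where
  open CommutativeRing R
  open import Algebra.Properties.Ring ring
    using (-‿involutive; -0#≈0#; -‿distribˡ-*; -‿distribʳ-*; -‿+-comm)
  open import Algebra.Properties.Semiring.Mult.TCOptimised semiring
    using (1+×; ×-homo-+; ×1-homo-*) renaming (_×_ to _×′_)
  open import Algebra.Properties.CommutativeSemigroup +-commutativeSemigroup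
    using (interchange)
  open import Relation.Binary.Reasoning.Setoid setoid

  signed : Sign → Carrier → Carrier
  signed Sign.+ x = x
  signed Sign.- x = - x

  -- The optimised _×′_ makes ⟦ + 1 ⟧ℤ and ⟦ + 2 ⟧ℤ reduce to 1# and 1# + 1#, so that
  -- con (+ 1) and con (+ 2) in solver terms match those expressions definitionally.
  ⟦_⟧ℤ : ℤ → Carrier
  ⟦ i ⟧ℤ = signed (ℤ.sign i) (ℤ.∣ i ∣ ×′ 1#)

  signed-cong : ∀ s {x y} → x ≈ y → signed s x ≈ signed s y
  signed-cong Sign.+ x≈y = x≈y
  signed-cong Sign.- x≈y = -‿cong x≈y

  signed-* : ∀ s t x y → signed (s Sign.* t) (x * y) ≈ signed s x * signed t y
  signed-* Sign.+ Sign.+ x y = refl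
  signed-* Sign.+ Sign.- x y = -‿distribʳ-* x y
  signed-* Sign.- Sign.+ x y = -‿distribˡ-* x y
  signed-* Sign.- Sign.- x y = begin
    x * y         ≈⟨ -‿involutive (x * y) ⟨
    - - (x * y)   ≈⟨ -‿cong (-‿distribʳ-* x y) ⟩
    - (x * - y)   ≈⟨ -‿distribˡ-* x (- y) ⟩
    - x * - y     ∎

  ⟦◃⟧ : ∀ s n → ⟦ s ℤ.◃ n ⟧ℤ ≈ signed s (n ×′ 1#)
  ⟦◃⟧ Sign.+ zero    = refl
  ⟦◃⟧ Sign.- zero    = sym -0#≈0#
  ⟦◃⟧ Sign.+ (suc n) = refl
  ⟦◃⟧ Sign.- (suc n) = refl

  ⟦⊖⟧ : ∀ m n → ⟦ m ℤ.⊖ n ⟧ℤ ≈ m ×′ 1# - n ×′ 1#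
  ⟦⊖⟧ zero    zero    = sym (-‿inverseʳ 0#)
  ⟦⊖⟧ zero    (suc n) = sym (+-identityˡ _)
  ⟦⊖⟧ (suc m) zero    = sym (trans (+-congˡ -0#≈0#) (+-identityʳ _))
  ⟦⊖⟧ (suc m) (suc n) = begin
    ⟦ suc m ℤ.⊖ suc n ⟧ℤ                    ≡⟨ ≡.cong ⟦_⟧ℤ (ℤ.[1+m]⊖[1+n]≡m⊖n m n) ⟩
    ⟦ m ℤ.⊖ n ⟧ℤ                            ≈⟨ ⟦⊖⟧ m n ⟩
    m ×′ 1# - n ×′ 1#                         ≈⟨ +-identityˡ _ ⟨
    0# + (m ×′ 1# - n ×′ 1#)                  ≈⟨ +-congʳ (-‿inverseʳ 1#) ⟨
    (1# - 1#) + (m ×′ 1# - n ×′ 1#)           ≈⟨ interchange _ _ _ _ ⟨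
    (1# + m ×′ 1#) + (- 1# + - (n ×′ 1#))     ≈⟨ +-congˡ (-‿+-comm 1# (n ×′ 1#)) ⟩
    (1# + m ×′ 1#) - (1# + n ×′ 1#)           ≈⟨ +-cong (1+× m 1#) (-‿cong (1+× n 1#)) ⟨
    suc m ×′ 1# - suc n ×′ 1#                 ∎

  ⟦⟧-+-homo : ∀ i j → ⟦ i ℤ.+ j ⟧ℤ ≈ ⟦ i ⟧ℤ + ⟦ j ⟧ℤ
  ⟦⟧-+-homo (+ m)    (+ n)    = ×-homo-+ 1# m n
  ⟦⟧-+-homo (+ m)    -[1+ n ] = ⟦⊖⟧ m (suc n)
  ⟦⟧-+-homo -[1+ m ] (+ n)    = trans (⟦⊖⟧ n (suc m)) (+-comm _ _)
  ⟦⟧-+-homo -[1+ m ] -[1+ n ] = begin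
    - (suc (suc (m ℕ.+ n)) ×′ 1#)            ≡⟨ ≡.cong (λ k → - (suc k ×′ 1#)) (ℕ.+-suc m n) ⟨
    - ((suc m ℕ.+ suc n) ×′ 1#)              ≈⟨ -‿cong (×-homo-+ 1# (suc m) (suc n)) ⟩
    - (suc m ×′ 1# + suc n ×′ 1#)             ≈⟨ -‿+-comm _ _ ⟨
    - (suc m ×′ 1#) + - (suc n ×′ 1#)         ∎

  ⟦⟧-*-homo : ∀ i j → ⟦ i ℤ.* j ⟧ℤ ≈ ⟦ i ⟧ℤ * ⟦ j ⟧ℤ
  ⟦⟧-*-homo i j = begin
    ⟦ s ℤ.◃ (ℤ.∣ i ∣ ℕ.* ℤ.∣ j ∣) ⟧ℤ                   ≈⟨ ⟦◃⟧ s (ℤ.∣ i ∣ ℕ.* ℤ.∣ j ∣) ⟩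
    signed s ((ℤ.∣ i ∣ ℕ.* ℤ.∣ j ∣) ×′ 1#)              ≈⟨ signed-cong s (×1-homo-* ℤ.∣ i ∣ ℤ.∣ j ∣) ⟩
    signed s ((ℤ.∣ i ∣ ×′ 1#) * (ℤ.∣ j ∣ ×′ 1#))         ≈⟨ signed-* (ℤ.sign i) (ℤ.sign j) _ _ ⟩
    ⟦ i ⟧ℤ * ⟦ j ⟧ℤ                                     ∎
    where
    s : Sign
    s = ℤ.sign i Sign.* ℤ.sign j

  ⟦⟧-‿homo : ∀ i → ⟦ ℤ.- i ⟧ℤ ≈ - ⟦ i ⟧ℤ
  ⟦⟧-‿homo (+ zero)  = sym -0#≈0#
  ⟦⟧-‿homo (+ suc n) = refl
  ⟦⟧-‿homo -[1+ n ]  = sym (-‿involutive _)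

  homomorphism : ℤ.+-*-rawRing -Raw-AlmostCommutative⟶ fromCommutativeRing R
  homomorphism = record
    { ⟦_⟧ = ⟦_⟧ℤ ; +-homo = ⟦⟧-+-homo ; *-homo = ⟦⟧-*-homo ; -‿homo = ⟦⟧-‿homo
    ; 0-homo = refl ; 1-homo = refl }

  ⟦⟧-≟ : ∀ i j → Maybe (⟦ i ⟧ℤ ≈ ⟦ j ⟧ℤ)
  ⟦⟧-≟ i j with i ℤ.≟ j
  ... | yes ≡.refl = just refl
  ... | no _       = nothing

  open import Algebra.Solver.Ring ℤ.+-*-rawRing (fromCommutativeRing R) homomorphism ⟦⟧-≟ public

module FormalPowerSeries {c ℓ : Level} (R : CommutativeRing c ℓ) where
  open CommutativeRing R hiding (zero)
  open RingNotions R
  open import Algebra.Properties.Ring ring using (-0#≈0#)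
  open import Algebra.Properties.CommutativeSemigroup +-commutativeSemigroup
    using (interchange; x∙yz≈y∙xz)
  open import Algebra.Properties.CommutativeSemigroup *-commutativeSemigroup
    using () renaming (x∙yz≈y∙xz to x*yz≈y*xz)
  open import Relation.Binary.Reasoning.Setoid setoid

  sumTo-cong : ∀ n {f g : ℕ → Carrier} → (∀ i → i ≤ n → f i ≈ g i) → sumTo n f ≈ sumTo n g
  sumTo-cong zero    f≈g = f≈g 0 ℕ.z≤n
  sumTo-cong (suc n) f≈g =
    +-cong (sumTo-cong n (λ i i≤n → f≈g i (ℕ.m≤n⇒m≤1+n i≤n))) (f≈g (suc n) ℕ.≤-refl)

  sumTo-zero : ∀ n {f : ℕ → Carrier} → (∀ i → i ≤ n → f i ≈ 0#) → sumTo n f ≈ 0#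
  sumTo-zero n f≈0 = trans (sumTo-cong n f≈0) (zeros n)
    where
    zeros : ∀ n → sumTo n (λ _ → 0#) ≈ 0#
    zeros zero    = refl
    zeros (suc n) = trans (+-identityʳ _) (zeros n)

  sumTo-+ : ∀ n (f g : ℕ → Carrier) → sumTo n (λ i → f i + g i) ≈ sumTo n f + sumTo n g
  sumTo-+ zero    f g = refl
  sumTo-+ (suc n) f g = trans (+-congʳ (sumTo-+ n f g)) (interchange _ _ _ _)

  sumTo-*ˡ : ∀ n a (f : ℕ → Carrier) → sumTo n (λ i → a * f i) ≈ a * sumTo n f
  sumTo-*ˡ zero    a f = refl
  sumTo-*ˡ (suc n) a f = trans (+-congʳ (sumTo-*ˡ n a f)) (sym (distribˡ _ _ _))

  sumTo-head : ∀ n (f : ℕ → Carrier) → sumTo (suc n) f ≈ f 0 + sumTo n (λ i → f (suc i))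
  sumTo-head zero    f = refl
  sumTo-head (suc n) f = trans (+-congʳ (sumTo-head n f)) (+-assoc _ _ _)

  sumTo-extend : ∀ {n N} {f : ℕ → Carrier} → n ≤ N → (∀ k → n < k → f k ≈ 0#) →
                 sumTo n f ≈ sumTo N f
  sumTo-extend {n} {f = f} n≤N f≈0 = go (ℕ.≤⇒≤′ n≤N)
    where
    go : ∀ {N} → n ≤′ N → sumTo n f ≈ sumTo N f
    go ≤′-refl       = refl
    go (≤′-step n≤N) =
      trans (go n≤N) (sym (trans (+-congˡ (f≈0 _ (s≤s (ℕ.≤′⇒≤ n≤N)))) (+-identityʳ _)))

  sumTo-comm : ∀ n m (f : ℕ → ℕ → Carrier) →
    sumTo n (λ i → sumTo m (λ k → f i k)) ≈ sumTo m (λ k → sumTo n (λ i → f i k))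
  sumTo-comm zero    m f = refl
  sumTo-comm (suc n) m f =
    trans (+-congʳ (sumTo-comm n m f)) (sym (sumTo-+ m _ (f (suc n))))

  tail : Series → Series
  tail f k = f (suc k)

  ⊛-suc : ∀ f g n → (f ⊛ g) (suc n) ≈ f 0 * g (suc n) + (tail f ⊛ g) n
  ⊛-suc f g n = sumTo-head n (λ i → f i * g (suc n ℕ.∸ i))

  ⊛-cong : ∀ {f f′ g g′} → f ≋ f′ → g ≋ g′ → f ⊛ g ≋ f′ ⊛ g′
  ⊛-cong f≋f′ g≋g′ n = sumTo-cong n (λ i _ → *-cong (f≋f′ i) (g≋g′ (n ℕ.∸ i)))

  ⊛-distribˡ : ∀ f g g′ → f ⊛ (g ⊕ g′) ≋ f ⊛ g ⊕ f ⊛ g′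
  ⊛-distribˡ f g g′ n = trans (sumTo-cong n (λ i _ → distribˡ _ _ _)) (sumTo-+ n _ _)

  ⊛-distribʳ : ∀ f g g′ → (g ⊕ g′) ⊛ f ≋ g ⊛ f ⊕ g′ ⊛ f
  ⊛-distribʳ f g g′ n = trans (sumTo-cong n (λ i _ → distribʳ _ _ _)) (sumTo-+ n _ _)

  ·ₛ-⊛ : ∀ a f g → (a ·ₛ f) ⊛ g ≋ a ·ₛ (f ⊛ g)
  ·ₛ-⊛ a f g n = trans (sumTo-cong n (λ i _ → *-assoc _ _ _)) (sumTo-*ˡ n a _)

  const-⊛ : ∀ a g → const a ⊛ g ≋ a ·ₛ g
  const-⊛ a g zero    = refl
  const-⊛ a g (suc n) =
    trans (⊛-suc (const a) g n) (trans (+-congˡ (sumTo-zero n (λ i _ → zeroˡ _))) (+-identityʳ _))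

  ⊛-identityˡ : ∀ g → const 1# ⊛ g ≋ g
  ⊛-identityˡ g n = trans (const-⊛ 1# g n) (*-identityˡ _)

  -- Peeling off the leading term of both factors in turn lets the recursion
  -- close up after two steps.
  ⊛-comm : ∀ f g → f ⊛ g ≋ g ⊛ f
  ⊛-comm f g zero             = *-comm _ _
  ⊛-comm f g (suc zero)       = trans (+-cong (*-comm _ _) (*-comm _ _)) (+-comm _ _)
  ⊛-comm f g (suc (suc m))    = begin
    (f ⊛ g) (suc (suc m))                                        ≈⟨ ⊛-suc f g (suc m) ⟩
    f 0 * g (2 ℕ.+ m) + (tail f ⊛ g) (suc m)                     ≈⟨ +-congˡ (⊛-comm (tail f) g (suc m)) ⟩
    f 0 * g (2 ℕ.+ m) + (g ⊛ tail f) (suc m)                     ≈⟨ +-congˡ (⊛-suc g (tail f) m) ⟩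
    f 0 * g (2 ℕ.+ m) + (g 0 * f (2 ℕ.+ m) + (tail g ⊛ tail f) m) ≈⟨ +-congˡ (+-congˡ (⊛-comm (tail g) (tail f) m)) ⟩
    f 0 * g (2 ℕ.+ m) + (g 0 * f (2 ℕ.+ m) + (tail f ⊛ tail g) m) ≈⟨ x∙yz≈y∙xz _ _ _ ⟩
    g 0 * f (2 ℕ.+ m) + (f 0 * g (2 ℕ.+ m) + (tail f ⊛ tail g) m) ≈⟨ +-congˡ (⊛-suc f (tail g) m) ⟨
    g 0 * f (2 ℕ.+ m) + (f ⊛ tail g) (suc m)                     ≈⟨ +-congˡ (⊛-comm f (tail g) (suc m)) ⟩
    g 0 * f (2 ℕ.+ m) + (tail g ⊛ f) (suc m)                     ≈⟨ ⊛-suc g f (suc m) ⟨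
    (g ⊛ f) (suc (suc m))                                        ∎

  ⊛-assoc : ∀ f g h → (f ⊛ g) ⊛ h ≋ f ⊛ (g ⊛ h)
  ⊛-assoc f g h zero    = *-assoc _ _ _
  ⊛-assoc f g h (suc n) = begin
    ((f ⊛ g) ⊛ h) (suc n)
      ≈⟨ ⊛-suc (f ⊛ g) h n ⟩
    (f 0 * g 0) * h (suc n) + (tail (f ⊛ g) ⊛ h) n
      ≈⟨ +-congˡ (⊛-cong {g = h} (⊛-suc f g) (λ _ → refl) n) ⟩
    (f 0 * g 0) * h (suc n) + ((f 0 ·ₛ tail g ⊕ tail f ⊛ g) ⊛ h) n
      ≈⟨ +-congˡ (trans (⊛-distribʳ h _ _ n) (+-cong (·ₛ-⊛ (f 0) (tail g) h n) (⊛-assoc (tail f) g h n))) ⟩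
    (f 0 * g 0) * h (suc n) + (f 0 * (tail g ⊛ h) n + (tail f ⊛ (g ⊛ h)) n)
      ≈⟨ +-assoc _ _ _ ⟨
    ((f 0 * g 0) * h (suc n) + f 0 * (tail g ⊛ h) n) + (tail f ⊛ (g ⊛ h)) n
      ≈⟨ +-congʳ (trans (+-congʳ (*-assoc _ _ _)) (sym (distribˡ _ _ _))) ⟩
    f 0 * (g 0 * h (suc n) + (tail g ⊛ h) n) + (tail f ⊛ (g ⊛ h)) n
      ≈⟨ +-congʳ (*-congˡ (⊛-suc g h n)) ⟨
    f 0 * (g ⊛ h) (suc n) + (tail f ⊛ (g ⊛ h)) n
      ≈⟨ ⊛-suc f (g ⊛ h) n ⟨
    (f ⊛ (g ⊛ h)) (suc n) ∎

  seriesRing : CommutativeRing c ℓ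
  seriesRing = record
    { Carrier = Series ; _≈_ = _≋_ ; _+_ = _⊕_ ; _*_ = _⊛_ ; -_ = λ f n → - f n
    ; 0# = λ _ → 0# ; 1# = const 1#
    ; isCommutativeRing = record
      { isRing = record
        { +-isAbelianGroup = record
          { isGroup = record
            { isMonoid = record
              { isSemigroup = record
                { isMagma = record
                  { isEquivalence = record
                    { refl = λ _ → refl ; sym = λ f≋g n → sym (f≋g n)
                    ; trans = λ f≋g g≋h n → trans (f≋g n) (g≋h n) }
                  ; ∙-cong = λ f≋f′ g≋g′ n → +-cong (f≋f′ n) (g≋g′ n) }
                ; assoc = λ _ _ _ _ → +-assoc _ _ _ }
              ; identity = (λ _ _ → +-identityˡ _) , (λ _ _ → +-identityʳ _) }
            ; inverse = (λ _ _ → -‿inverseˡ _) , (λ _ _ → -‿inverseʳ _)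
            ; ⁻¹-cong = λ f≋g n → -‿cong (f≋g n) }
          ; comm = λ _ _ _ → +-comm _ _ }
        ; *-cong = ⊛-cong
        ; *-assoc = ⊛-assoc
        ; *-identity = ⊛-identityˡ , (λ f n → trans (⊛-comm f (const 1#) n) (⊛-identityˡ f n))
        ; distrib = ⊛-distribˡ , ⊛-distribʳ }
      ; *-comm = ⊛-comm } }

  private module S = CommutativeRing seriesRing
  open import Algebra.Properties.Ring S.ring using (-‿distribʳ-*)
  open import Algebra.Properties.Group +-group using (x∙y⁻¹≈ε⇒x≈y)
  open import Algebra.Properties.Group S.+-group using (x≈y⇒x∙y⁻¹≈ε)

  const-cong : ∀ {x y} → x ≈ y → const x ≋ const y
  const-cong x≈y zero    = x≈y
  const-cong x≈y (suc n) = refl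

  const-+ : ∀ x y → const (x + y) ≋ const x ⊕ const y
  const-+ x y zero    = refl
  const-+ x y (suc n) = sym (+-identityʳ 0#)

  const-* : ∀ x y → const (x * y) ≋ const x ⊛ const y
  const-* x y zero    = refl
  const-* x y (suc n) = sym (trans (const-⊛ x (const y) (suc n)) (zeroʳ x))

  const‿- : ∀ x → const (- x) ≋ S.- const x
  const‿- x zero    = refl
  const‿- x (suc n) = sym -0#≈0#

  X⊛-suc : ∀ F k → (X ⊛ F) (suc k) ≈ F k
  X⊛-suc F k = begin
    (X ⊛ F) (suc k)                      ≈⟨ ⊛-suc X F k ⟩
    0# * F (suc k) + (tail X ⊛ F) k      ≈⟨ +-cong (zeroˡ _) (⊛-cong {g = F} tailX≋1 (λ _ → refl) k) ⟩
    0# + (const 1# ⊛ F) k                ≈⟨ +-identityˡ _ ⟩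
    (const 1# ⊛ F) k                     ≈⟨ ⊛-identityˡ F k ⟩
    F k                                  ∎
    where
    tailX≋1 : tail X ≋ const 1#
    tailX≋1 zero    = refl
    tailX≋1 (suc n) = refl

  ⊛≋0⇒≋0 : ∀ {E Z} → (∀ x → E 0 * x ≈ 0# → x ≈ 0#) → (∀ n → (E ⊛ Z) n ≈ 0#) → ∀ n → Z n ≈ 0#
  ⊛≋0⇒≋0 {E} {Z} regular EZ≈0 = <-rec (λ n → Z n ≈ 0#) vanish
    where
    vanish : ∀ n → (∀ {m} → m < n → Z m ≈ 0#) → Z n ≈ 0#
    vanish zero    _     = regular (Z 0) (EZ≈0 0)
    vanish (suc n) Z<n≈0 = regular (Z (suc n)) (begin
      E 0 * Z (suc n)                       ≈⟨ +-identityʳ _ ⟨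
      E 0 * Z (suc n) + 0#                  ≈⟨ +-congˡ (sumTo-zero n (λ i _ →
                                                 trans (*-congˡ (Z<n≈0 (s≤s (ℕ.m∸n≤m n i)))) (zeroʳ _))) ⟨
      E 0 * Z (suc n) + (tail E ⊛ Z) n      ≈⟨ ⊛-suc E Z n ⟨
      (E ⊛ Z) (suc n)                       ≈⟨ EZ≈0 (suc n) ⟩
      0#                                    ∎)

  ⊛-cancelˡ : ∀ {E F F′} → (∀ x → E 0 * x ≈ 0# → x ≈ 0#) → E ⊛ F ≋ E ⊛ F′ → F ≋ F′
  ⊛-cancelˡ {E} {F} {F′} regular EF≋EF′ n =
    x∙y⁻¹≈ε⇒x≈y (F n) (F′ n) (⊛≋0⇒≋0 {Z = F S.- F′} regular E[F-F′]≋0 n)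
    where
    E[F-F′]≋0 : E ⊛ (F S.- F′) ≋ S.0#
    E[F-F′]≋0 = S.trans (S.distribˡ E F (S.- F′))
                (S.trans (S.+-congˡ (S.sym (-‿distribʳ-* E F′))) (x≈y⇒x∙y⁻¹≈ε EF≋EF′))

  module Composition (G : Series) (G0≈0 : G 0 ≈ 0#) where

    pow-vanishes : ∀ k n → n < k → pow G k n ≈ 0#
    pow-vanishes (suc k) zero    _          = trans (*-congʳ G0≈0) (zeroˡ _)
    pow-vanishes (suc k) (suc n) (s≤s n<k)  = begin
      (G ⊛ pow G k) (suc n)                          ≈⟨ ⊛-suc G (pow G k) n ⟩
      G 0 * pow G k (suc n) + (tail G ⊛ pow G k) n   ≈⟨ +-cong (trans (*-congʳ G0≈0) (zeroˡ _)) (sumTo-zero n (λ i _ →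
           trans (*-congˡ (pow-vanishes k (n ℕ.∸ i) (ℕ.≤-<-trans (ℕ.m∸n≤m n i) n<k))) (zeroʳ _))) ⟩
      0# + 0#                                        ≈⟨ +-identityˡ 0# ⟩
      0#                                             ∎

    compose-extend : ∀ F {n N} → n ≤ N → compose F G n ≈ sumTo N (λ k → F k * pow G k n)
    compose-extend F {n} n≤N =
      sumTo-extend n≤N (λ k n<k → trans (*-congˡ (pow-vanishes k n n<k)) (zeroʳ _))

    compose-cong : ∀ {F F′} → F ≋ F′ → compose F G ≋ compose F′ G
    compose-cong F≋F′ n = sumTo-cong n (λ k _ → *-congʳ (F≋F′ k))

    compose-⊕ : ∀ F F′ → compose (F ⊕ F′) G ≋ compose F G ⊕ compose F′ G
    compose-⊕ F F′ n = trans (sumTo-cong n (λ k _ → distribʳ _ _ _)) (sumTo-+ n _ _)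

    compose-const⊛ : ∀ a F → compose (const a ⊛ F) G ≋ const a ⊛ compose F G
    compose-const⊛ a F n = begin
      compose (const a ⊛ F) G n   ≈⟨ compose-cong (const-⊛ a F) n ⟩
      compose (a ·ₛ F) G n        ≈⟨ sumTo-cong n (λ k _ → *-assoc _ _ _) ⟩
      sumTo n (λ k → a * (F k * pow G k n))  ≈⟨ sumTo-*ˡ n a _ ⟩
      (a ·ₛ compose F G) n        ≈⟨ const-⊛ a (compose F G) n ⟨
      (const a ⊛ compose F G) n   ∎

    compose-1 : compose (const 1#) G ≋ const 1#
    compose-1 zero    = *-identityˡ 1#
    compose-1 (suc n) = sumTo-zero (suc n) λ { zero _ → zeroʳ 1# ; (suc k) _ → zeroˡ _ }

    compose-X⊛ : ∀ F → compose (X ⊛ F) G ≋ G ⊛ compose F G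
    compose-X⊛ F zero    = trans (*-identityʳ _) (trans (zeroˡ _) (sym (trans (*-congʳ G0≈0) (zeroˡ _))))
    compose-X⊛ F (suc m) = begin
      compose (X ⊛ F) G (suc m)
        ≈⟨ sumTo-head m _ ⟩
      (0# * F 0) * 0# + sumTo m (λ k → (X ⊛ F) (suc k) * pow G (suc k) (suc m))
        ≈⟨ +-cong (zeroʳ _) (sumTo-cong m (λ k _ → *-congʳ (X⊛-suc F k))) ⟩
      0# + sumTo m (λ k → F k * (G ⊛ pow G k) (suc m))
        ≈⟨ +-identityˡ _ ⟩
      sumTo m (λ k → F k * (G ⊛ pow G k) (suc m))
        ≈⟨ sumTo-extend (ℕ.n≤1+n m) (λ k m<k → trans (*-congˡ (pow-vanishes (suc k) (suc m) (s≤s m<k))) (zeroʳ _)) ⟩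
      sumTo (suc m) (λ k → F k * (G ⊛ pow G k) (suc m))
        ≈⟨ sumTo-cong (suc m) (λ k _ → sym (sumTo-*ˡ (suc m) (F k) _)) ⟩
      sumTo (suc m) (λ k → sumTo (suc m) (λ i → F k * (G i * pow G k (suc m ℕ.∸ i))))
        ≈⟨ sumTo-cong (suc m) (λ k _ → sumTo-cong (suc m) (λ i _ → x*yz≈y*xz _ _ _)) ⟩
      sumTo (suc m) (λ k → sumTo (suc m) (λ i → G i * (F k * pow G k (suc m ℕ.∸ i))))
        ≈⟨ sumTo-comm (suc m) (suc m) _ ⟩
      sumTo (suc m) (λ i → sumTo (suc m) (λ k → G i * (F k * pow G k (suc m ℕ.∸ i))))
        ≈⟨ sumTo-cong (suc m) (λ i i≤m → trans (sumTo-*ˡ (suc m) (G i) _)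
                                          (*-congˡ (sym (compose-extend F (ℕ.m∸n≤m (suc m) i))))) ⟩
      (G ⊛ compose F G) (suc m) ∎

module ThronIdentities {c ℓ : Level} (R : CommutativeRing c ℓ) where
  open CommutativeRing R
  open IntegerRingSolver R using (solve; _:+_; _:*_; _:-_; :-_; _:=_; con)
  open import Algebra.Properties.Monoid *-monoid using (insertʳ; cancelʳ)
  open import Relation.Binary.Reasoning.Setoid setoid

  +-vanishʳ : ∀ x {v} y → v ≈ 0# → x + v * y ≈ x
  +-vanishʳ x y v≈0 = trans (+-congˡ (trans (*-congʳ v≈0) (zeroˡ y))) (+-identityʳ x)

  *-cancelʳ-unit : ∀ {t d x y} → t * d ≈ 1# → x * d ≈ y * d → x ≈ y
  *-cancelʳ-unit {t} {d} {x} {y} td≈1 xd≈yd = begin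
    x            ≈⟨ insertʳ dt≈1 x ⟩
    (x * d) * t  ≈⟨ *-congʳ xd≈yd ⟩
    (y * d) * t  ≈⟨ cancelʳ dt≈1 y ⟩
    y            ∎
    where
    dt≈1 : d * t ≈ 1#
    dt≈1 = trans (*-comm d t) td≈1

  thron-parameters : ∀ {a b c d half} → (1# + 1#) * half ≈ 1# →
    d * d ≈ b * b - ((1# + 1#) + (1# + 1#)) * c →
    let q = (b - d) * half
        r = - d
        s = - (((1# + 1#) * a - d - b) * half)
    in (a ≈ q - r - s) × (b ≈ (1# + 1#) * q - r) × (c ≈ q * (q - r))
  thron-parameters {a} {b} {c} {d} {half} 2half≈1 d²≈disc =
    sym (trans (solve 4 (λ a b d h →
                  (b :- d) :* h :- (:- d) :- (:- ((con (+ 2) :* a :- d :- b) :* h))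
                  := a :+ (con (+ 2) :* h :- con (+ 1)) :* (a :- d)) refl a b d half)
               (+-vanishʳ a (a - d) ε≈0)) ,
    sym (trans (solve 3 (λ b d h →
                  con (+ 2) :* ((b :- d) :* h) :- (:- d)
                  := b :+ (con (+ 2) :* h :- con (+ 1)) :* (b :- d)) refl b d half)
               (+-vanishʳ b (b - d) ε≈0)) ,
    sym (trans (solve 4 (λ b c d h →
                  let ε = con (+ 2) :* h :- con (+ 1)
                      δ = d :* d :- (b :* b :- (con (+ 2) :+ con (+ 2)) :* c)
                  in ((b :- d) :* h) :* ((b :- d) :* h :- (:- d))
                     := c :+ ε :* (c :* (con (+ 2) :+ ε) :- (b :- d) :* d :* h) :+ δ :* (:- (h :* h)))
                  refl b c d half)
               (trans (+-vanishʳ _ _ δ≈0) (+-vanishʳ c _ ε≈0)))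
    where
    ε≈0 : (1# + 1#) * half - 1# ≈ 0#
    ε≈0 = trans (+-congʳ 2half≈1) (-‿inverseʳ 1#)
    δ≈0 : d * d - (b * b - ((1# + 1#) + (1# + 1#)) * c) ≈ 0#
    δ≈0 = trans (+-congʳ d²≈disc) (-‿inverseʳ _)

  thron-quadratic : ∀ q r s x u → u * (1# - r * x - s * (x * u)) ≈ 1# →
    let d = 1# - q * x - s * (x * u)
    in d * d + ((1# + 1#) * q - r) * x * d + q * (q - r) * x * x ≈ d + (q - r - s) * x
  thron-quadratic q r s x u u-eq = begin
    d * d + ((1# + 1#) * q - r) * x * d + q * (q - r) * x * x
      ≈⟨ solve 5 (λ q r s x u →
           let d = con (+ 1) :- q :* x :- s :* (x :* u)
           in d :* d :+ (con (+ 2) :* q :- r) :* x :* d :+ q :* (q :- r) :* x :* x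
              := d :+ (q :- r :- s) :* x :+ (x :- x :* (u :* (con (+ 1) :- r :* x :- s :* (x :* u)))) :* s)
           refl q r s x u ⟩
    d + (q - r - s) * x + (x - x * (u * (1# - r * x - s * (x * u)))) * s
      ≈⟨ +-vanishʳ _ s (trans (+-congˡ (-‿cong (trans (*-congˡ u-eq) (*-identityʳ x)))) (-‿inverseʳ x)) ⟩
    d + (q - r - s) * x ∎
    where
    d : Carrier
    d = 1# - q * x - s * (x * u)

  -- With t = 1/d and g = x t, this says that y ↦ N(y)/E(y), where E(y) = 1 + b y + c y²
  -- and N(y) = 1 + a y, takes the value d = x/g at y = g.
  thron-functional-equation : ∀ {a b c q r s} x u t →
    a ≈ q - r - s → b ≈ (1# + 1#) * q - r → c ≈ q * (q - r) →
    u * (1# - r * x - s * (x * u)) ≈ 1# → t * (1# - q * x - s * (x * u)) ≈ 1# →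
    let g = x * t
        d = 1# - q * x - s * (x * u)
    in (1# + b * g + c * (g * g)) * d ≈ 1# + a * g
  thron-functional-equation {a} {b} {c} {q} {r} {s} x u t a≈ b≈ c≈ u-eq td≈1 =
    *-cancelʳ-unit td≈1 (begin
      ((1# + b * g + c * (g * g)) * d) * d
        ≈⟨ solve 4 (λ b c g d → ((con (+ 1) :+ b :* g :+ c :* (g :* g)) :* d) :* d
                               := d :* d :+ b :* (g :* d) :* d :+ c :* (g :* d) :* (g :* d)) refl b c g d ⟩
      d * d + b * (g * d) * d + c * (g * d) * (g * d)
        ≈⟨ +-cong (+-congˡ (*-congʳ (*-cong b≈ gd≈x))) (*-cong (*-cong c≈ gd≈x) gd≈x) ⟩
      d * d + ((1# + 1#) * q - r) * x * d + q * (q - r) * x * x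
        ≈⟨ thron-quadratic q r s x u u-eq ⟩
      d + (q - r - s) * x
        ≈⟨ +-congˡ (*-cong (sym a≈) (sym gd≈x)) ⟩
      d + a * (g * d)
        ≈⟨ solve 3 (λ a g d → d :+ a :* (g :* d) := (con (+ 1) :+ a :* g) :* d) refl a g d ⟩
      (1# + a * g) * d ∎)
    where
    g d : Carrier
    g = x * t
    d = 1# - q * x - s * (x * u)
    gd≈x : g * d ≈ x
    gd≈x = trans (*-assoc x t d) (trans (*-congˡ td≈1) (*-identityʳ x))

module ThronContinuedFraction {c ℓ : Level} (R : CommutativeRing c ℓ) where
  private module R = CommutativeRing R
  open RingNotions R
  open FormalPowerSeries R
  open CommutativeRing seriesRing
  open IntegerRingSolver seriesRing using (solve; _:+_; _:*_; _:=_; con)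
  open ThronIdentities seriesRing using (thron-functional-equation)
  open import Relation.Binary.Reasoning.Setoid setoid

  thronFraction-isRevertTransform : ∀ (a b c q r s : R.Carrier) →
    a R.≈ q R.- r R.- s → b R.≈ (R.1# R.+ R.1#) R.* q R.- r → c R.≈ q R.* (q R.- r) →
    ∀ (h U T : Series) →
    (const R.1# ⊕ b ·ₛ X ⊕ c ·ₛ (X ⊛ X)) ⊛ h ≋ const R.1# ⊕ a ·ₛ X →
    U ⊛ (const R.1# ⊖ r ·ₛ X ⊖ s ·ₛ (X ⊛ U)) ≋ const R.1# →
    T ⊛ (const R.1# ⊖ q ·ₛ X ⊖ s ·ₛ (X ⊛ U)) ≋ const R.1# →
    IsRevertTransform h T
  thronFraction-isRevertTransform a b c q r s a≈ b≈ c≈ h U T h-eq U-eq T-eq = G0≈0 , (begin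
    compose (X * h) G   ≈⟨ compose-X⊛ h ⟩
    G * P               ≈⟨ *-congˡ (⊛-cancelˡ {F = P} {D} E-regular (trans E-P (sym E-D))) ⟩
    G * D               ≈⟨ *-assoc X T D ⟩
    X * (T * D)         ≈⟨ *-congˡ T-eq′ ⟩
    X * 1#              ≈⟨ *-identityʳ X ⟩
    X                   ∎)
    where
    G : Series
    G = X * T
    G0≈0 : G 0 R.≈ R.0#
    G0≈0 = R.zeroˡ (T 0)
    open Composition G G0≈0

    A B C Q Rr S : Series
    A = const a ; B = const b ; C = const c ; Q = const q ; Rr = const r ; S = const s

    P D E : Series
    P = compose h G
    D = 1# - Q * X - S * (X * U)
    E = 1# + B * G + C * (G * G)

    A≈ : A ≈ Q - Rr - S
    A≈ = trans (const-cong a≈) (trans (const-+ _ _) (+-cong (trans (const-+ _ _) (+-congˡ (const‿- r))) (const‿- s)))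
    B≈ : B ≈ (1# + 1#) * Q - Rr
    B≈ = trans (const-cong b≈) (trans (const-+ _ _) (+-cong (trans (const-* _ _) (*-congʳ {Q} (const-+ _ _))) (const‿- r)))
    C≈ : C ≈ Q * (Q - Rr)
    C≈ = trans (const-cong c≈) (trans (const-* _ _) (*-congˡ (trans (const-+ _ _) (+-congˡ (const‿- r)))))

    ·ₛ≈const* : ∀ k F → k ·ₛ F ≈ const k * F
    ·ₛ≈const* k F = sym (const-⊛ k F)

    denominator : ∀ p → const R.1# ⊖ p ·ₛ X ⊖ s ·ₛ (X ⊛ U) ≈ 1# - const p * X - S * (X * U)
    denominator p = +-cong (+-congˡ (-‿cong (·ₛ≈const* p X))) (-‿cong (·ₛ≈const* s (X * U)))

    h-eq′ : (1# + B * X + C * (X * X)) * h ≈ 1# + A * X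
    h-eq′ = trans (*-congʳ {h} (+-cong (+-congˡ (sym (·ₛ≈const* b X))) (sym (·ₛ≈const* c (X * X)))))
                  (trans h-eq (+-congˡ (·ₛ≈const* a X)))
    U-eq′ : U * (1# - Rr * X - S * (X * U)) ≈ 1#
    U-eq′ = trans (*-congˡ (sym (denominator r))) U-eq
    T-eq′ : T * D ≈ 1#
    T-eq′ = trans (*-congˡ (sym (denominator q))) T-eq

    compose-X : compose X G ≈ G
    compose-X = begin
      compose X G          ≈⟨ compose-cong (sym (*-identityʳ X)) ⟩
      compose (X * 1#) G   ≈⟨ compose-X⊛ 1# ⟩
      G * compose 1# G     ≈⟨ *-congˡ compose-1 ⟩
      G * 1#               ≈⟨ *-identityʳ G ⟩
      G                    ∎

    E-P : E * P ≈ 1# + A * G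
    E-P = begin
      E * P
        ≈⟨ solve 4 (λ b c g p → (con (+ 1) :+ b :* g :+ c :* (g :* g)) :* p
                               := p :+ b :* (g :* p) :+ c :* (g :* (g :* p))) refl B C G P ⟩
      P + B * (G * P) + C * (G * (G * P))
        ≈⟨ +-cong (+-congˡ (*-congˡ (compose-X⊛ h))) (*-congˡ (trans (compose-X⊛ (X * h)) (*-congˡ (compose-X⊛ h)))) ⟨
      P + B * compose (X * h) G + C * compose (X * (X * h)) G
        ≈⟨ +-cong (+-congˡ (compose-const⊛ b _)) (compose-const⊛ c _) ⟨
      P + compose (B * (X * h)) G + compose (C * (X * (X * h))) G
        ≈⟨ trans (compose-⊕ _ _) (+-congʳ (compose-⊕ _ _)) ⟨
      compose (h + B * (X * h) + C * (X * (X * h))) G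
        ≈⟨ compose-cong (solve 4 (λ b c x h → h :+ b :* (x :* h) :+ c :* (x :* (x :* h))
                                             := (con (+ 1) :+ b :* x :+ c :* (x :* x)) :* h) refl B C X h) ⟩
      compose ((1# + B * X + C * (X * X)) * h) G
        ≈⟨ compose-cong h-eq′ ⟩
      compose (1# + A * X) G
        ≈⟨ trans (compose-⊕ _ _) (+-cong compose-1 (trans (compose-const⊛ a X) (*-congˡ compose-X))) ⟩
      1# + A * G ∎

    E-D : E * D ≈ 1# + A * G
    E-D = thron-functional-equation X U T A≈ B≈ C≈ U-eq′ T-eq′

    E0≈1 : E 0 R.≈ R.1#
    E0≈1 = R.trans (R.+-cong (R.+-congˡ (R.trans (R.*-congˡ G0≈0) (R.zeroʳ b)))
                             (R.trans (R.*-congˡ (R.trans (R.*-congʳ G0≈0) (R.zeroˡ _))) (R.zeroʳ c)))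
                   (R.trans (R.+-identityʳ _) (R.+-identityʳ _))

    E-regular : ∀ x → E 0 R.* x R.≈ R.0# → x R.≈ R.0#
    E-regular x E0x≈0 = R.trans (R.sym (R.trans (R.*-congʳ E0≈1) (R.*-identityˡ x))) E0x≈0

module _ {c₁ ℓ₁ c₂ ℓ₂} {K : CommutativeRing c₁ ℓ₁} {L : CommutativeRing c₂ ℓ₂}
         {ι : CommutativeRing.Carrier K → CommutativeRing.Carrier L}
         (mono : RingMorphisms.IsRingMonomorphism (CommutativeRing.rawRing K) (CommutativeRing.rawRing L) ι)
         where
  private
    module K = RingNotions K
    module L = CommutativeRing L
    module ι = RingMorphisms.IsRingMonomorphism mono
    module Lⁿ = RingNotions L

  natCast-homo : ∀ n → ι (K.natCast n) L.≈ Lⁿ.natCast n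
  natCast-homo zero    = ι.0#-homo
  natCast-homo (suc n) = L.trans (ι.+-homo _ _) (L.+-cong ι.1#-homo (natCast-homo n))

  CharZero-mono : K.CharZero → Lⁿ.CharZero
  CharZero-mono charK n n≈0 =
    charK n (ι.injective (L.trans (natCast-homo (suc n)) (L.trans n≈0 (L.sym ι.0#-homo))))

proposition3 : ∀ {c₁ ℓ₁ c₂ ℓ₂} (K : Field c₁ ℓ₁) (L : Field c₂ ℓ₂) →
    RingNotions.CharZero (Field.commutativeRing K) →
    (ι : Field.Carrier K → Field.Carrier L) →
    RingMorphisms.IsRingMonomorphism (Field.rawRing K) (Field.rawRing L) ι →
    (a b c : Field.Carrier K) (d : Field.Carrier L) →
    let open Field L
        open RingNotions commutativeRing
        two = 1# + 1#
        four = two + two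
        half = two ⁻¹
        q = (ι b - d) * half
        r = - d
        s = - ((two * ι a - d - ι b) * half)
    in d * d ≈ ι b * ι b - four * ι c →
       (ι a ≈ q - r - s) × (ι b ≈ two * q - r) × (ι c ≈ q * (q - r)) ×
       (∀ (h U T : Series) →
         (const 1# ⊕ ι b ·ₛ X ⊕ ι c ·ₛ (X ⊛ X)) ⊛ h ≋ const 1# ⊕ ι a ·ₛ X →
         U ⊛ (const 1# ⊖ r ·ₛ X ⊖ s ·ₛ (X ⊛ U)) ≋ const 1# →
         T ⊛ (const 1# ⊖ q ·ₛ X ⊖ s ·ₛ (X ⊛ U)) ≋ const 1# →
         IsRevertTransform h T)
proposition3 K L charK ι mono a b c d d²≈disc =
  let a≈ , b≈ , c≈ = thron-parameters (inverseʳ (1# + 1#) two≉0) d²≈disc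
  in  a≈ , b≈ , c≈ , thronFraction-isRevertTransform (ι a) (ι b) (ι c) _ _ _ a≈ b≈ c≈
  where
  open Field L
  open ThronIdentities commutativeRing using (thron-parameters)
  open ThronContinuedFraction commutativeRing using (thronFraction-isRevertTransform)

  two≉0 : ¬ (1# + 1# ≈ 0#)
  two≉0 two≈0 = CharZero-mono {K = Field.commutativeRing K} {L = commutativeRing} mono charK 1 (trans (+-congˡ (+-identityʳ 1#)) two≈0)
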